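{- Let $P,Q$ be Dyck paths of size $n$. Then $P\le Q$ in the ascent poset $\mathbb{D}_n$ if and only if $P$ lies weakly below $Q$ and the ascent composition $c(P)$ refines $c(Q)$. Equivalently, the second condition means that for every descent of $Q$ there is a descent of $P$ lying on the same line of slope $-1$.
   Context: A Dyck path of size $n$ is a lattice path from $(0,0)$ with $n$ up steps $U=(1,1)$ and $n$ down steps $D=(1,-1)$, ending on the $x$-axis and never going strictly below it. An ascent (resp. descent) is a maximal non-empty run of consecutive up (resp. down) steps. The ascent composition $c(P)=(c_1,\dots,c_k)$ lists the lengths of the successive ascents of $P$. $P$ lies weakly below $Q$ if for every $\ell$ the prefix of length $\ell$ of $P$ contains at most as many up steps as the prefix of length $\ell$ of $Q$. A composition $c$ refines $c'=(c'_1,\dots,c'_i)$ if $c$ can be written as a concatenation of compositions of $c'_1,\dots,c'_i$ in order. $\mathbb{D}_n$ is the set of Dyck paths of size $n$ ordered by the reflexive-transitive closure of the relation replacing a factor $DU^kD$ ($k\ge 1$) by $U^kDD$. -}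

module Defs where

open import Data.Nat using (ℕ; zero; suc; _+_; _≤_; _≥_)
open import Data.Integer using (ℤ; +_; -[1+_]; _-_) renaming (_+_ to _+ℤ_; _≤_ to _≤ℤ_)
open import Data.List using (List; []; _∷_; _++_; take; length; replicate; concat)
open import Data.Nat.ListAction using (sum)
open import Data.List.Membership.Propositional using (_∈_)
open import Data.Product using (Σ; _×_; _,_)
open import Relation.Binary.PropositionalEquality using (_≡_)
open import Relation.Binary.Construct.Closure.ReflexiveTransitive using (Star)

-- Steps of a lattice path: U = (1,1), D = (1,-1).
data Step : Set where
  U D : Step

Path : Set
Path = List Step

#U : Path → ℕ
#U []      = 0
#U (U ∷ p) = suc (#U p)
#U (D ∷ p) = #U p

#D : Path → ℕ
#D []      = 0
#D (U ∷ p) = #D p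
#D (D ∷ p) = suc (#D p)

height : Path → ℤ
height p = + #U p - + #D p

record IsDyck (n : ℕ) (p : Path) : Set where
  field
    ups       : #U p ≡ n
    downs     : #D p ≡ n
    nonneg    : ∀ (ℓ : ℕ) → + 0 ≤ℤ height (take ℓ p)

data Cover : Path → Path → Set where
  cover : ∀ (a b : Path) (k : ℕ) → k ≥ 1 →
          Cover (a ++ (D ∷ replicate k U ++ (D ∷ b)))
                (a ++ (replicate k U ++ (D ∷ D ∷ b)))

_≤𝔻_ : Path → Path → Set
P ≤𝔻 Q = Star Cover P Q

WeaklyBelow : Path → Path → Set
WeaklyBelow P Q = ∀ (ℓ : ℕ) → #U (take ℓ P) ≤ #U (take ℓ Q)

-- Ascent composition: lengths of the maximal runs of up steps, in order.
-- ascAux r p: r = length of the current (pending) run of U's.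
ascAux : ℕ → Path → List ℕ
ascAux zero    []      = []
ascAux (suc r) []      = suc r ∷ []
ascAux r       (U ∷ p) = ascAux (suc r) p
ascAux zero    (D ∷ p) = ascAux zero p
ascAux (suc r) (D ∷ p) = suc r ∷ ascAux zero p

ascentComposition : Path → List ℕ
ascentComposition = ascAux zero

IsComposition : ℕ → List ℕ → Set
IsComposition m c = (∀ {x : ℕ} → x ∈ c → x ≥ 1) × sum c ≡ m

data Blocks : List (List ℕ) → List ℕ → Set where
  []  : Blocks [] []
  _∷_ : ∀ {b bs m ms} → IsComposition m b → Blocks bs ms → Blocks (b ∷ bs) (m ∷ ms)

Refines : List ℕ → List ℕ → Set
Refines c c' = Σ (List (List ℕ)) (λ bs → Blocks bs c' × concat bs ≡ c)

-- Write a Dyck path as U D^p₁ U D^p₂ ⋯ U D^pₙ.  A cover D U^k D ↦ U^k D D raises the path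
-- and merges two adjacent ascents, so both conditions are necessary.  Conversely, weakly
-- below means q₁ + ⋯ + qᵢ ≤ p₁ + ⋯ + pᵢ for all i, and refinement means that qᵢ > 0 only
-- where pᵢ > 0.  Reading both vectors from the left, the surplus of down steps of P over Q
-- is slid rightwards by covers across the next ascent and absorbed into the next descent of
-- P; alignment ensures that Q never needs a descent where P has none.

module Submission where

open import Defs
open import Data.Nat using (ℕ; zero; suc; _+_; _∸_; _≤_; _<_; _≥_; z≤n; s≤s)
open import Data.Nat.Properties
open import Data.Nat.ListAction using (sum)
import Data.Integer.Properties as ℤ
open import Data.List using (List; []; _∷_; _++_; _∷ʳ_; take; length; replicate; concat; initLast; _∷ʳ′_)
open import Data.List.Properties using (++-assoc; ++-identityʳ)
open import Data.List.Relation.Unary.All using (All; []; _∷_)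
open import Data.List.Relation.Unary.Any using (Any; here; there)
open import Data.List.Relation.Binary.Pointwise using (Pointwise; []; _∷_)
open import Data.Product using (∃; ∃₂; _×_; _,_)
open import Data.Sum using (_⊎_; inj₁; inj₂)
open import Data.Empty using (⊥; ⊥-elim)
open import Function.Bundles using (_⇔_; mk⇔)
open import Relation.Binary.PropositionalEquality
open import Relation.Binary.Construct.Closure.ReflexiveTransitive using (ε; _◅_; _◅◅_; gmap; fold)
open import Relation.Nullary using (yes; no)

U^ D^ : ℕ → Path
U^ k = replicate k U
D^ k = replicate k D

D^-+ : ∀ m n X → D^ (m + n) ++ X ≡ D^ m ++ D^ n ++ X
D^-+ zero    n X = refl
D^-+ (suc m) n X = cong (D ∷_) (D^-+ m n X)

#U-++ : ∀ a b → #U (a ++ b) ≡ #U a + #U b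
#U-++ []      b = refl
#U-++ (U ∷ a) b = cong suc (#U-++ a b)
#U-++ (D ∷ a) b = #U-++ a b

#D-++ : ∀ a b → #D (a ++ b) ≡ #D a + #D b
#D-++ []      b = refl
#D-++ (U ∷ a) b = #D-++ a b
#D-++ (D ∷ a) b = cong suc (#D-++ a b)

take-length-++ : ∀ {A : Set} (xs ys : List A) → take (length xs) (xs ++ ys) ≡ xs
take-length-++ []       ys = refl
take-length-++ (x ∷ xs) ys = cong (x ∷_) (take-length-++ xs ys)

Cover-++ˡ : ∀ a {P Q} → Cover P Q → Cover (a ++ P) (a ++ Q)
Cover-++ˡ a (cover a′ b k k≥1) =
  subst₂ Cover (++-assoc a a′ _) (++-assoc a a′ _) (cover (a ++ a′) b k k≥1)

≤𝔻-++ˡ : ∀ a {P Q} → P ≤𝔻 Q → (a ++ P) ≤𝔻 (a ++ Q)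
≤𝔻-++ˡ a = gmap (a ++_) (Cover-++ˡ a)

WeaklyBelow-++ˡ : ∀ a {P Q} → WeaklyBelow P Q → WeaklyBelow (a ++ P) (a ++ Q)
WeaklyBelow-++ˡ []      below = below
WeaklyBelow-++ˡ (_ ∷ a) below zero    = z≤n
WeaklyBelow-++ˡ (U ∷ a) below (suc ℓ) = s≤s (WeaklyBelow-++ˡ a below ℓ)
WeaklyBelow-++ˡ (D ∷ a) below (suc ℓ) = WeaklyBelow-++ˡ a below ℓ

#U-take-U∷≤ : ∀ ℓ X → #U (take ℓ (U ∷ X)) ≤ suc (#U (take ℓ (D ∷ X)))
#U-take-U∷≤ zero    X = z≤n
#U-take-U∷≤ (suc ℓ) X = ≤-refl

D∷U^-below-U^∷D : ∀ k X → WeaklyBelow (D ∷ U^ k ++ X) (U^ k ++ D ∷ X)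
D∷U^-below-U^∷D k       X zero    = z≤n
D∷U^-below-U^∷D zero    X (suc ℓ) = ≤-refl
D∷U^-below-U^∷D (suc k) X (suc ℓ) =
  ≤-trans (#U-take-U∷≤ ℓ (U^ k ++ X)) (s≤s (D∷U^-below-U^∷D k X ℓ))

Cover⇒WeaklyBelow : ∀ {P Q} → Cover P Q → WeaklyBelow P Q
Cover⇒WeaklyBelow (cover a b k _) = WeaklyBelow-++ˡ a (D∷U^-below-U^∷D k (D ∷ b))

≤𝔻⇒WeaklyBelow : ∀ {P Q} → P ≤𝔻 Q → WeaklyBelow P Q
≤𝔻⇒WeaklyBelow = fold WeaklyBelow (λ c below ℓ → ≤-trans (Cover⇒WeaklyBelow c ℓ) (below ℓ))
                                   (λ ℓ → ≤-refl)

-- Refinement as merging of adjacent parts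

infix 4 _⊑_

data _⊑_ : List ℕ → List ℕ → Set where
  []   : [] ⊑ []
  keep : ∀ x {c c′} → c ⊑ c′ → x ∷ c ⊑ x ∷ c′
  join : ∀ x {y c c′} → c ⊑ y ∷ c′ → x ∷ c ⊑ x + y ∷ c′

⊑-refl : ∀ c → c ⊑ c
⊑-refl []      = []
⊑-refl (x ∷ c) = keep x (⊑-refl c)

⊑-++ˡ : ∀ e {c c′} → c ⊑ c′ → e ++ c ⊑ e ++ c′
⊑-++ˡ []      R = R
⊑-++ˡ (x ∷ e) R = keep x (⊑-++ˡ e R)

⊑-trans : ∀ {a b c} → a ⊑ b → b ⊑ c → a ⊑ c
⊑-trans []         []          = []
⊑-trans (keep x R) (keep .x S) = keep x (⊑-trans R S)
⊑-trans (keep x R) (join .x S) = join x (⊑-trans R S)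
⊑-trans (join x {y} R) (keep ._ S) = join x (⊑-trans R (keep y S))
⊑-trans {x ∷ a} (join x {y} R) (join ._ {z} {c′ = c′} S) =
  subst (λ m → x ∷ a ⊑ m ∷ c′) (sym (+-assoc x y z)) (join x (⊑-trans R (join y S)))

⊑-∷⁻ : ∀ {x z c c′} → x ∷ c ⊑ z ∷ c′ →
       (x ≡ z × c ⊑ c′) ⊎ ∃ λ y → z ≡ x + y × c ⊑ y ∷ c′
⊑-∷⁻ (keep x R)     = inj₁ (refl , R)
⊑-∷⁻ (join x {y} R) = inj₂ (y , refl , R)

⊑-head-≤ : ∀ {x z c c′} → x ∷ c ⊑ z ∷ c′ → x ≤ z
⊑-head-≤ R with ⊑-∷⁻ R
... | inj₁ (refl , _)     = ≤-refl
... | inj₂ (y , refl , _) = m≤m+n _ y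

⊑-head-positive : ∀ {c y c′} → All (_≥ 1) c → c ⊑ y ∷ c′ → y ≥ 1
⊑-head-positive (x≥1 ∷ _) R = ≤-trans x≥1 (⊑-head-≤ R)

⊑-uncons : ∀ {x c c′} → All (_≥ 1) c → x ∷ c ⊑ x ∷ c′ → c ⊑ c′
⊑-uncons {x} pos R with ⊑-∷⁻ R
... | inj₁ (_ , R′)      = R′
... | inj₂ (y , x≡x+y , R′) =
  ⊥-elim (<⇒≢ (m<m+n x (⊑-head-positive pos R′)) x≡x+y)

⊑-unjoin : ∀ {x h c c′} → h ≥ 1 → x ∷ c ⊑ x + h ∷ c′ → c ⊑ h ∷ c′
⊑-unjoin {x} {h} {c} {c′} h≥1 R with ⊑-∷⁻ R
... | inj₁ (x≡x+h , _)      = ⊥-elim (<⇒≢ (m<m+n x h≥1) x≡x+h)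
... | inj₂ (y , x+h≡x+y , R′) = subst (λ m → c ⊑ m ∷ c′) (sym (+-cancelˡ-≡ x h y x+h≡x+y)) R′

⊑⇒Refines : ∀ {c c′} → c ⊑ c′ → All (_≥ 1) c → Refines c c′
⊑⇒Refines [] [] = [] , [] , refl
⊑⇒Refines (keep x R) (x≥1 ∷ pos) with ⊑⇒Refines R pos
... | bs , blocks , eq =
  (x ∷ []) ∷ bs , ((λ { (here refl) → x≥1 }) , +-identityʳ x) ∷ blocks , cong (x ∷_) eq
⊑⇒Refines (join x R) (x≥1 ∷ pos) with ⊑⇒Refines R pos
... | (b ∷ bs) , ((b≥1 , sum≡) ∷ blocks) , eq =
  (x ∷ b) ∷ bs , ((λ { (here refl) → x≥1 ; (there i) → b≥1 i }) , cong (x +_) sum≡) ∷ blocks ,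
  cong (x ∷_) eq

⊑-merge : ∀ x b {c c′} → c ⊑ c′ → x ∷ b ++ c ⊑ sum (x ∷ b) ∷ c′
⊑-merge x []      {c} {c′} R = subst (λ m → x ∷ c ⊑ m ∷ c′) (sym (+-identityʳ x)) (keep x R)
⊑-merge x (y ∷ b) R = join x (⊑-merge y b R)

Refines⇒⊑ : ∀ {c c′} → All (_≥ 1) c′ → Refines c c′ → c ⊑ c′
Refines⇒⊑ pos (bs , blocks , refl) = concat-⊑ pos blocks
  where
    concat-⊑ : ∀ {bs ms} → All (_≥ 1) ms → Blocks bs ms → concat bs ⊑ ms
    concat-⊑ [] [] = []
    concat-⊑ (m≥1 ∷ _)   (_∷_ {[]} (_ , refl) _) = ⊥-elim (<⇒≢ m≥1 refl)
    concat-⊑ (_   ∷ pos) (_∷_ {x ∷ b} (_ , refl) blocks) =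
      ⊑-merge x b (concat-⊑ pos blocks)

completedAscents : ℕ → Path → List ℕ
completedAscents r       []      = []
completedAscents r       (U ∷ a) = completedAscents (suc r) a
completedAscents zero    (D ∷ a) = completedAscents zero a
completedAscents (suc r) (D ∷ a) = suc r ∷ completedAscents 0 a

openAscent : ℕ → Path → ℕ
openAscent r []      = r
openAscent r (U ∷ a) = openAscent (suc r) a
openAscent r (D ∷ a) = openAscent 0 a

ascAux-U : ∀ r X → ascAux r (U ∷ X) ≡ ascAux (suc r) X
ascAux-U zero    X = refl
ascAux-U (suc r) X = refl

ascAux-++ : ∀ r a X → ascAux r (a ++ X) ≡ completedAscents r a ++ ascAux (openAscent r a) X
ascAux-++ r       []      X = refl
ascAux-++ r       (U ∷ a) X = trans (ascAux-U r (a ++ X)) (ascAux-++ (suc r) a X)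
ascAux-++ zero    (D ∷ a) X = ascAux-++ zero a X
ascAux-++ (suc r) (D ∷ a) X = cong (suc r ∷_) (ascAux-++ 0 a X)

ascAux-U^ : ∀ k r X → ascAux r (U^ k ++ X) ≡ ascAux (r + k) X
ascAux-U^ zero    r X = cong (λ m → ascAux m X) (sym (+-identityʳ r))
ascAux-U^ (suc k) r X = begin
  ascAux r (U ∷ U^ k ++ X) ≡⟨ ascAux-U r _ ⟩
  ascAux (suc r) (U^ k ++ X) ≡⟨ ascAux-U^ k (suc r) X ⟩
  ascAux (suc r + k) X     ≡⟨ cong (λ m → ascAux m X) (sym (+-suc r k)) ⟩
  ascAux (r + suc k) X     ∎
  where open ≡-Reasoning

Cover-ascAux-⊑ : ∀ r k b → k ≥ 1 → ascAux r (D ∷ U^ k ++ D ∷ b) ⊑ ascAux r (U^ k ++ D ∷ D ∷ b)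
Cover-ascAux-⊑ zero (suc k) b _
  rewrite ascAux-U^ (suc k) 0 (D ∷ b) | ascAux-U^ (suc k) 0 (D ∷ D ∷ b) = ⊑-refl _
Cover-ascAux-⊑ (suc r) (suc k) b _
  rewrite ascAux-U^ (suc k) 0 (D ∷ b) | ascAux-U^ (suc k) (suc r) (D ∷ D ∷ b) =
  join (suc r) (keep (suc k) (⊑-refl (ascAux 0 b)))

Cover⇒⊑ : ∀ {P Q} → Cover P Q → ascentComposition P ⊑ ascentComposition Q
Cover⇒⊑ (cover a b k k≥1) =
  subst₂ _⊑_ (sym (ascAux-++ 0 a _)) (sym (ascAux-++ 0 a _))
    (⊑-++ˡ (completedAscents 0 a) (Cover-ascAux-⊑ (openAscent 0 a) k b k≥1))

≤𝔻⇒⊑ : ∀ {P Q} → P ≤𝔻 Q → ascentComposition P ⊑ ascentComposition Q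
≤𝔻⇒⊑ = fold (λ P Q → ascentComposition P ⊑ ascentComposition Q)
            (λ c R → ⊑-trans (Cover⇒⊑ c) R) (⊑-refl _)

ascAux-positive : ∀ r X → All (_≥ 1) (ascAux r X)
ascAux-positive zero    []      = []
ascAux-positive (suc r) []      = s≤s z≤n ∷ []
ascAux-positive zero    (U ∷ X) = ascAux-positive 1 X
ascAux-positive (suc r) (U ∷ X) = ascAux-positive (suc (suc r)) X
ascAux-positive zero    (D ∷ X) = ascAux-positive zero X
ascAux-positive (suc r) (D ∷ X) = s≤s z≤n ∷ ascAux-positive 0 X

fromDescents : List ℕ → Path
fromDescents []       = []
fromDescents (p ∷ ps) = U ∷ D^ p ++ fromDescents ps

leadingDowns : Path → ℕ
leadingDowns []      = 0
leadingDowns (U ∷ P) = 0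
leadingDowns (D ∷ P) = suc (leadingDowns P)

descents : Path → List ℕ
descents []      = []
descents (U ∷ P) = leadingDowns P ∷ descents P
descents (D ∷ P) = descents P

D^leadingDowns++fromDescents : ∀ P → D^ (leadingDowns P) ++ fromDescents (descents P) ≡ P
D^leadingDowns++fromDescents []      = refl
D^leadingDowns++fromDescents (U ∷ P) = cong (U ∷_) (D^leadingDowns++fromDescents P)
D^leadingDowns++fromDescents (D ∷ P) = cong (D ∷_) (D^leadingDowns++fromDescents P)

#U-D^++ : ∀ k X → #U (D^ k ++ X) ≡ #U X
#U-D^++ zero    X = refl
#U-D^++ (suc k) X = #U-D^++ k X

#D-D^++ : ∀ k X → #D (D^ k ++ X) ≡ k + #D X
#D-D^++ zero    X = refl
#D-D^++ (suc k) X = cong suc (#D-D^++ k X)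

#U-fromDescents : ∀ ps → #U (fromDescents ps) ≡ length ps
#U-fromDescents []       = refl
#U-fromDescents (p ∷ ps) = cong suc (trans (#U-D^++ p _) (#U-fromDescents ps))

#D-fromDescents : ∀ ps → #D (fromDescents ps) ≡ sum ps
#D-fromDescents []       = refl
#D-fromDescents (p ∷ ps) = trans (#D-D^++ p _) (cong (p +_) (#D-fromDescents ps))

fromDescents-∷ʳ : ∀ ps p → fromDescents (ps ∷ʳ p) ≡ fromDescents ps ++ U ∷ D^ p
fromDescents-∷ʳ []       p = cong (U ∷_) (++-identityʳ (D^ p))
fromDescents-∷ʳ (q ∷ ps) p =
  cong (U ∷_) (trans (cong (D^ q ++_) (fromDescents-∷ʳ ps p)) (sym (++-assoc (D^ q) _ _)))

Dyck-#D≤#U : ∀ {n P} → IsDyck n P → ∀ ℓ → #D (take ℓ P) ≤ #U (take ℓ P)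
Dyck-#D≤#U dyck ℓ = ℤ.drop‿+≤+ (ℤ.0≤i-j⇒j≤i (IsDyck.nonneg dyck ℓ))

-- The prefix a would end at height −1.
¬Dyck-++U : ∀ {n} a → IsDyck n (a ++ U ∷ []) → ⊥
¬Dyck-++U a dyck = 1+n≰n (begin
  suc (#U a)             ≡⟨ +-comm 1 (#U a) ⟩
  #U a + 1               ≡⟨ sym (#U-++ a (U ∷ [])) ⟩
  #U (a ++ U ∷ [])       ≡⟨ trans (IsDyck.ups dyck) (sym (IsDyck.downs dyck)) ⟩
  #D (a ++ U ∷ [])       ≡⟨ trans (#D-++ a (U ∷ [])) (+-identityʳ (#D a)) ⟩
  #D a                   ≡⟨ cong #D (sym (take-length-++ a _)) ⟩
  #D (take (length a) _) ≤⟨ Dyck-#D≤#U dyck (length a) ⟩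
  #U (take (length a) _) ≡⟨ cong #U (take-length-++ a _) ⟩
  #U a                   ∎)
  where open ≤-Reasoning

Dyck-leadingDowns : ∀ {n P} → IsDyck n P → leadingDowns P ≡ 0
Dyck-leadingDowns {P = []}    _ = refl
Dyck-leadingDowns {P = U ∷ _} _ = refl
Dyck-leadingDowns {P = D ∷ _} dyck with Dyck-#D≤#U dyck 1
... | ()

module _ {n : ℕ} {P : Path} (dyck : IsDyck n P) where

  fromDescents-descents : fromDescents (descents P) ≡ P
  fromDescents-descents =
    trans (cong (λ k → D^ k ++ fromDescents (descents P)) (sym (Dyck-leadingDowns dyck)))
          (D^leadingDowns++fromDescents P)

  length-descents : length (descents P) ≡ n
  length-descents = begin
    length (descents P)            ≡⟨ sym (#U-fromDescents (descents P)) ⟩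
    #U (fromDescents (descents P)) ≡⟨ cong #U fromDescents-descents ⟩
    #U P                           ≡⟨ IsDyck.ups dyck ⟩
    n                              ∎
    where open ≡-Reasoning

  sum-descents : sum (descents P) ≡ n
  sum-descents = begin
    sum (descents P)               ≡⟨ sym (#D-fromDescents (descents P)) ⟩
    #D (fromDescents (descents P)) ≡⟨ cong #D fromDescents-descents ⟩
    #D P                           ≡⟨ IsDyck.downs dyck ⟩
    n                              ∎
    where open ≡-Reasoning

  Dyck-last-descent≢0 : ∀ ps → descents P ≢ ps ∷ʳ 0
  Dyck-last-descent≢0 ps eq = ¬Dyck-++U (fromDescents ps) (subst (IsDyck n) P≡ dyck)
    where
      P≡ : P ≡ fromDescents ps ++ U ∷ []
      P≡ = trans (sym fromDescents-descents) (trans (cong fromDescents eq) (fromDescents-∷ʳ ps 0))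

data NoTrailingZero : List ℕ → Set where
  []  : NoTrailingZero []
  [_] : ∀ x → NoTrailingZero (suc x ∷ [])
  _∷_ : ∀ x {y ys} → NoTrailingZero (y ∷ ys) → NoTrailingZero (x ∷ y ∷ ys)

NoTrailingZero-∷ʳ : ∀ ps x → NoTrailingZero (ps ∷ʳ suc x)
NoTrailingZero-∷ʳ []           x = [ x ]
NoTrailingZero-∷ʳ (p ∷ [])     x = p ∷ [ x ]
NoTrailingZero-∷ʳ (p ∷ q ∷ ps) x = p ∷ NoTrailingZero-∷ʳ (q ∷ ps) x

NoTrailingZero-or-∷ʳ0 : ∀ ps → NoTrailingZero ps ⊎ ∃ λ xs → ps ≡ xs ∷ʳ 0
NoTrailingZero-or-∷ʳ0 ps with initLast ps
... | []             = inj₁ []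
... | xs ∷ʳ′ zero    = inj₂ (xs , refl)
... | xs ∷ʳ′ suc x   = inj₁ (NoTrailingZero-∷ʳ xs x)

Dyck-NoTrailingZero : ∀ {n P} → IsDyck n P → NoTrailingZero (descents P)
Dyck-NoTrailingZero {P = P} dyck with NoTrailingZero-or-∷ʳ0 (descents P)
... | inj₁ ntz        = ntz
... | inj₂ (xs , eq)  = ⊥-elim (Dyck-last-descent≢0 dyck xs eq)

slide : ∀ e k B → k ≥ 1 → (D^ e ++ U^ k ++ D ∷ B) ≤𝔻 (U^ k ++ D ∷ D^ e ++ B)
slide zero    k B _   = ε
slide (suc e) k B k≥1 = ≤𝔻-++ˡ (D ∷ []) (slide e k B k≥1) ◅◅ (cover [] (D^ e ++ B) k k≥1 ◅ ε)

addToFirstDescent : ℕ → List ℕ → List ℕ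
addToFirstDescent e []           = []
addToFirstDescent e (zero ∷ ps)  = zero ∷ addToFirstDescent e ps
addToFirstDescent e (suc p ∷ ps) = suc (e + p) ∷ ps

addToFirstDescent-zero : ∀ ps → addToFirstDescent 0 ps ≡ ps
addToFirstDescent-zero []           = refl
addToFirstDescent-zero (zero ∷ ps)  = cong (zero ∷_) (addToFirstDescent-zero ps)
addToFirstDescent-zero (suc p ∷ ps) = refl

firstDescent : ∀ {ps} → Any (_≥ 1) ps →
               ∃₂ λ k B → k ≥ 1 × fromDescents ps ≡ U^ k ++ D ∷ B ×
                          ∀ e → fromDescents (addToFirstDescent e ps) ≡ U^ k ++ D ∷ D^ e ++ B
firstDescent {suc p ∷ ps} _ =
  1 , D^ p ++ fromDescents ps , s≤s z≤n , refl , λ e → cong (λ X → U ∷ D ∷ X) (D^-+ e p _)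
firstDescent {zero ∷ ps} (here ())
firstDescent {zero ∷ ps} (there has) with firstDescent has
... | k , B , _ , eq , eq′ = suc k , B , s≤s z≤n , cong (U ∷_) eq , λ e → cong (U ∷_) (eq′ e)

absorbDowns : ∀ e {ps} → Any (_≥ 1) ps →
              (D^ e ++ fromDescents ps) ≤𝔻 fromDescents (addToFirstDescent e ps)
absorbDowns e has with firstDescent has
... | k , B , k≥1 , eq , eq′ =
  subst₂ (λ X Y → (D^ e ++ X) ≤𝔻 Y) (sym eq) (sym (eq′ e)) (slide e k B k≥1)

-- In Admissible s ps qs, s counts the down steps by which P is ahead of Q so far.
data Admissible : ℕ → List ℕ → List ℕ → Set where
  []      : Admissible 0 [] []
  flat    : ∀ {s ps qs} → Admissible s ps qs → Admissible s (0 ∷ ps) (0 ∷ qs)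
  descent : ∀ {s p q ps qs} → q ≤ s + suc p → Admissible (s + suc p ∸ q) ps qs →
            Admissible s (suc p ∷ ps) (q ∷ qs)

Admissible-descent : ∀ {s ps qs} → Admissible s ps qs → s ≥ 1 → Any (_≥ 1) ps
Admissible-descent (flat A)      s≥1 = there (Admissible-descent A s≥1)
Admissible-descent (descent _ _) _   = here (s≤s z≤n)

mutual
  Admissible⇒≤𝔻 : ∀ {s ps qs} → Admissible s ps qs →
                  fromDescents (addToFirstDescent s ps) ≤𝔻 fromDescents qs
  Admissible⇒≤𝔻 []       = ε
  Admissible⇒≤𝔻 (flat A) = ≤𝔻-++ˡ (U ∷ []) (Admissible⇒≤𝔻 A)
  Admissible⇒≤𝔻 (descent {s} {p} {q} {ps} {qs} q≤ A) =
    subst (λ X → (U ∷ X) ≤𝔻 fromDescents (q ∷ qs)) merge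
      (≤𝔻-++ˡ (U ∷ D^ q) (Admissible⇒D^++≤𝔻 _ A))
    where
      merge : D^ q ++ D^ (s + suc p ∸ q) ++ fromDescents ps ≡ D^ (suc (s + p)) ++ fromDescents ps
      merge = trans (sym (D^-+ q _ _))
                    (cong (λ m → D^ m ++ fromDescents ps) (trans (m+[n∸m]≡n q≤) (+-suc s p)))

  Admissible⇒D^++≤𝔻 : ∀ e {ps qs} → Admissible e ps qs → (D^ e ++ fromDescents ps) ≤𝔻 fromDescents qs
  Admissible⇒D^++≤𝔻 zero {ps} A =
    subst (λ ps′ → fromDescents ps′ ≤𝔻 _) (addToFirstDescent-zero ps) (Admissible⇒≤𝔻 A)
  Admissible⇒D^++≤𝔻 (suc e) A =
    absorbDowns (suc e) (Admissible-descent A (s≤s z≤n)) ◅◅ Admissible⇒≤𝔻 A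

WeaklyBelowBy : ℕ → Path → Path → Set
WeaklyBelowBy s X Y = ∀ ℓ → #U (take ℓ X) ≤ #U (take (s + ℓ) Y)

#U-take-D^++ : ∀ k ℓ X → #U (take (k + ℓ) (D^ k ++ X)) ≡ #U (take ℓ X)
#U-take-D^++ zero    ℓ X = refl
#U-take-D^++ (suc k) ℓ X = #U-take-D^++ k ℓ X

#U-take-D^++-≤ : ∀ {j k} X → j ≤ k → #U (take j (D^ k ++ X)) ≡ 0
#U-take-D^++-≤ X z≤n       = refl
#U-take-D^++-≤ X (s≤s j≤k) = #U-take-D^++-≤ X j≤k

-- Otherwise, right after the second up step of P, Q would still be on its first descent.
WeaklyBelowBy⇒first-descent-≤ : ∀ s {p p′ q ps qs} →
  WeaklyBelowBy s (fromDescents (p ∷ p′ ∷ ps)) (fromDescents (q ∷ qs)) → q ≤ s + p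
WeaklyBelowBy⇒first-descent-≤ s {p} {p′} {q} {ps} {qs} below with q ≤? s + p
... | yes q≤ = q≤
... | no  q≰ = ⊥-elim (1+n≰n {1} (begin
  2                                                        ≡⟨ cong suc (sym (#U-take-D^++ p 1 _)) ⟩
  #U (take (suc (p + 1)) (fromDescents (p ∷ p′ ∷ ps)))     ≤⟨ below (suc (p + 1)) ⟩
  #U (take (s + suc (p + 1)) (fromDescents (q ∷ qs)))      ≡⟨ cong (λ j → #U (take j Q)) (+-suc s (p + 1)) ⟩
  suc (#U (take (s + (p + 1)) (D^ q ++ fromDescents qs)))  ≡⟨ cong suc (#U-take-D^++-≤ _ s+p+1≤q) ⟩
  1                                                        ∎))
  where
    open ≤-Reasoning
    Q : Path
    Q = fromDescents (q ∷ qs)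
    s+p+1≤q : s + (p + 1) ≤ q
    s+p+1≤q = subst (_≤ q) (sym (trans (cong (s +_) (+-comm p 1)) (+-suc s p))) (≰⇒> q≰)

WeaklyBelowBy-tail : ∀ {s p q ps qs} → q ≤ s + p →
  WeaklyBelowBy s (fromDescents (p ∷ ps)) (fromDescents (q ∷ qs)) →
  WeaklyBelowBy (s + p ∸ q) (fromDescents ps) (fromDescents qs)
WeaklyBelowBy-tail {s} {p} {q} {ps} {qs} q≤ below ℓ = ≤-pred (begin
  suc (#U (take ℓ (fromDescents ps)))                          ≡⟨ cong suc (sym (#U-take-D^++ p ℓ _)) ⟩
  #U (take (suc (p + ℓ)) (fromDescents (p ∷ ps)))              ≤⟨ below (suc (p + ℓ)) ⟩
  #U (take (s + suc (p + ℓ)) (fromDescents (q ∷ qs)))          ≡⟨ cong (λ j → #U (take j Q)) index ⟩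
  suc (#U (take (q + (s + p ∸ q + ℓ)) (D^ q ++ fromDescents qs))) ≡⟨ cong suc (#U-take-D^++ q _ _) ⟩
  suc (#U (take (s + p ∸ q + ℓ) (fromDescents qs)))            ∎)
  where
    open ≤-Reasoning
    Q : Path
    Q = fromDescents (q ∷ qs)
    index : s + suc (p + ℓ) ≡ suc (q + (s + p ∸ q + ℓ))
    index = begin-equality
      s + suc (p + ℓ)         ≡⟨ +-suc s (p + ℓ) ⟩
      suc (s + (p + ℓ))       ≡⟨ cong suc (sym (+-assoc s p ℓ)) ⟩
      suc (s + p + ℓ)         ≡⟨ cong (λ m → suc (m + ℓ)) (sym (m+[n∸m]≡n q≤)) ⟩
      suc (q + (s + p ∸ q) + ℓ) ≡⟨ cong suc (+-assoc q _ ℓ) ⟩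
      suc (q + (s + p ∸ q + ℓ)) ∎

sum-tail : ∀ {s p q ps qs} → q ≤ s + p → s + sum (p ∷ ps) ≡ sum (q ∷ qs) →
           s + p ∸ q + sum ps ≡ sum qs
sum-tail {s} {p} {q} {ps} {qs} q≤ eq = +-cancelˡ-≡ q _ _ (begin
  q + (s + p ∸ q + sum ps) ≡⟨ sym (+-assoc q _ (sum ps)) ⟩
  q + (s + p ∸ q) + sum ps ≡⟨ cong (_+ sum ps) (m+[n∸m]≡n q≤) ⟩
  s + p + sum ps           ≡⟨ +-assoc s p (sum ps) ⟩
  s + (p + sum ps)         ≡⟨ eq ⟩
  q + sum qs               ∎)
  where open ≡-Reasoning

-- Every descent of Q is matched by one of P after the same number of up steps, that is,
-- on the same line of slope −1.
Aligned : List ℕ → List ℕ → Set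
Aligned = Pointwise (λ p q → p ≡ 0 → q ≡ 0)

first-descent-≤ : ∀ s {p q ps qs} → WeaklyBelowBy s (fromDescents (p ∷ ps)) (fromDescents (q ∷ qs)) →
                  s + sum (p ∷ ps) ≡ sum (q ∷ qs) → Aligned ps qs → q ≤ s + p
first-descent-≤ s {p} {q} _ eq [] = ≤-reflexive (begin
  q         ≡⟨ sym (+-identityʳ q) ⟩
  q + 0     ≡⟨ sym eq ⟩
  s + (p + 0) ≡⟨ cong (s +_) (+-identityʳ p) ⟩
  s + p     ∎)
  where open ≡-Reasoning
first-descent-≤ s {p} {q} {p′ ∷ ps} {qs} below _ (_ ∷ _) =
  WeaklyBelowBy⇒first-descent-≤ s {p} {p′} {q} {ps} {qs} below

WeaklyBelowBy⇒Admissible : ∀ s {ps qs} → WeaklyBelowBy s (fromDescents ps) (fromDescents qs) →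
                            s + sum ps ≡ sum qs → Aligned ps qs → Admissible s ps qs
WeaklyBelowBy⇒Admissible s _ eq [] =
  subst (λ m → Admissible m [] []) (sym (trans (sym (+-identityʳ s)) eq)) []
WeaklyBelowBy⇒Admissible s {p ∷ ps} {q ∷ qs} below eq (aligned ∷ rest) with first-descent-≤ s below eq rest
WeaklyBelowBy⇒Admissible s {zero ∷ ps} {q ∷ qs} below eq (aligned ∷ rest) | q≤ with aligned refl
... | refl = flat (subst (λ m → Admissible m ps qs) (+-identityʳ s)
                    (WeaklyBelowBy⇒Admissible _ (WeaklyBelowBy-tail {p = 0} {ps = ps} {qs} q≤ below)
                                                (sum-tail {p = 0} {ps = ps} {qs} q≤ eq) rest))
WeaklyBelowBy⇒Admissible s {suc p ∷ ps} {q ∷ qs} below eq (aligned ∷ rest) | q≤ =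
  descent q≤ (WeaklyBelowBy⇒Admissible _ (WeaklyBelowBy-tail {p = suc p} {ps = ps} {qs} q≤ below)
                                        (sum-tail {p = suc p} {ps = ps} {qs} q≤ eq) rest)

ascAux-D^++ : ∀ k X → ascAux 0 (D^ k ++ X) ≡ ascAux 0 X
ascAux-D^++ zero    X = refl
ascAux-D^++ (suc k) X = ascAux-D^++ k X

ascAux-fromDescents-suc : ∀ r p ps → ascAux r (fromDescents (suc p ∷ ps)) ≡ suc r ∷ ascAux 0 (fromDescents ps)
ascAux-fromDescents-suc r p ps = trans (ascAux-U r _) (cong (suc r ∷_) (ascAux-D^++ p _))

ascAux-open : ∀ a r X → ∃₂ λ h t → a < h × ascAux (suc a) X ≡ h ∷ t × ascAux (suc (a + r)) X ≡ r + h ∷ t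
ascAux-open a r []      = suc a , [] , ≤-refl , refl , cong (_∷ []) (+-comm (suc a) r)
ascAux-open a r (U ∷ X) with ascAux-open (suc a) r X
... | h , t , a<h , eq₁ , eq₂ = h , t , <⇒≤ a<h , eq₁ , eq₂
ascAux-open a r (D ∷ X) = suc a , ascAux 0 X , ≤-refl , refl , cong (_∷ ascAux 0 X) (+-comm (suc a) r)

-- r is the ascent that both paths have open.  If p = 0 < q, the ascent of P outgrows that
-- of Q, which no refinement allows.
⊑⇒Aligned : ∀ r {ps qs} → length ps ≡ length qs → NoTrailingZero ps →
            ascAux r (fromDescents ps) ⊑ ascAux r (fromDescents qs) → Aligned ps qs
⊑⇒Aligned r {_} {[]}         _  []      _ = []
⊑⇒Aligned r {_} {_ ∷ []}     _  [ _ ]   _ = (λ ()) ∷ []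
⊑⇒Aligned r {_} {[]}         () [ _ ]   _
⊑⇒Aligned r {_} {_ ∷ _ ∷ _} () [ _ ]   _
⊑⇒Aligned r {_} {[]}         () (_ ∷ _) _
⊑⇒Aligned r {zero ∷ _} {zero ∷ qs} len (_ ∷ ntz) R =
  (λ _ → refl) ∷ ⊑⇒Aligned (suc r) (suc-injective len) ntz
                   (subst₂ _⊑_ (ascAux-U r _) (ascAux-U r _) R)
⊑⇒Aligned r {zero ∷ y ∷ ys} {suc q ∷ qs} _ _ R
  with ascAux-open 0 (suc r) (D^ y ++ fromDescents ys)
... | h , t , h≥1 , _ , eq =
  ⊥-elim (<⇒≱ (m<m+n (suc r) h≥1)
           (⊑-head-≤ (subst₂ _⊑_ (trans (ascAux-U r _) eq) (ascAux-fromDescents-suc r q qs) R)))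
⊑⇒Aligned r {suc x ∷ y ∷ ys} {suc q ∷ qs} len (_ ∷ ntz) R =
  (λ ()) ∷ ⊑⇒Aligned 0 (suc-injective len) ntz
             (⊑-uncons (ascAux-positive 0 (fromDescents (y ∷ ys)))
               (subst₂ _⊑_ (ascAux-fromDescents-suc r x (y ∷ ys)) (ascAux-fromDescents-suc r q qs) R))
⊑⇒Aligned r {suc _ ∷ _ ∷ _} {zero ∷ []} () _ _
⊑⇒Aligned r {suc x ∷ y ∷ ys} {zero ∷ q′ ∷ qs} len (_ ∷ ntz) R
  with ascAux-open 0 (suc r) (D^ q′ ++ fromDescents qs)
... | h , t , h≥1 , eq₀ , eq =
  (λ ()) ∷ ⊑⇒Aligned 0 (suc-injective len) ntz
             (subst (ascAux 0 (fromDescents (y ∷ ys)) ⊑_) (sym eq₀)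
               (⊑-unjoin h≥1 (subst₂ _⊑_ (ascAux-fromDescents-suc r x (y ∷ ys))
                                         (trans (ascAux-U r _) eq) R)))

descents-≤𝔻 : ∀ {ps qs} → length ps ≡ length qs → sum ps ≡ sum qs → NoTrailingZero ps →
              WeaklyBelow (fromDescents ps) (fromDescents qs) →
              ascentComposition (fromDescents ps) ⊑ ascentComposition (fromDescents qs) →
              fromDescents ps ≤𝔻 fromDescents qs
descents-≤𝔻 length≡ sum≡ ntz below refines =
  Admissible⇒D^++≤𝔻 0 (WeaklyBelowBy⇒Admissible 0 below sum≡ (⊑⇒Aligned 0 length≡ ntz refines))

proposition2p1 : ∀ (n : ℕ) (P Q : Path) → IsDyck n P → IsDyck n Q →
                   (P ≤𝔻 Q) ⇔ (WeaklyBelow P Q × Refines (ascentComposition P) (ascentComposition Q))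
proposition2p1 n P Q dP dQ = mk⇔
  (λ P≤Q → ≤𝔻⇒WeaklyBelow P≤Q , ⊑⇒Refines (≤𝔻⇒⊑ P≤Q) (ascAux-positive 0 P))
  (λ { (below , refines) →
    subst₂ _≤𝔻_ eP eQ
      (descents-≤𝔻 (trans (length-descents dP) (sym (length-descents dQ)))
                   (trans (sum-descents dP) (sym (sum-descents dQ)))
                   (Dyck-NoTrailingZero dP)
                   (subst₂ WeaklyBelow (sym eP) (sym eQ) below)
                   (subst₂ (λ X Y → ascentComposition X ⊑ ascentComposition Y) (sym eP) (sym eQ)
                     (Refines⇒⊑ (ascAux-positive 0 Q) refines))) })
  where
    eP : fromDescents (descents P) ≡ P
    eP = fromDescents-descents dP
    eQ : fromDescents (descents Q) ≡ Q
    eQ = fromDescents-descents dQ
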